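{- (i) Let $l,k,m$ be natural numbers with $n=2m$ and $k<m$. Then $e(l,m-k)$ and $e(l,m+k)$ are cyclotomic equivalent modulo $2^n-1$. (ii) Let $l,k,m$ be natural numbers with $n=2m+1$ and $k\le m$. Then $e(l,m-k+1)$ and $e(l,m+k)$ are cyclotomic equivalent modulo $2^n-1$.
   Context: For natural numbers $l,K$, $e(l,K)=\sum_{j=0}^{l-1}2^{jK}=\frac{2^{lK}-1}{2^K-1}$. Two exponents $d,e$ are cyclotomic equivalent modulo $2^n-1$ if there is a natural number $a$ with $2^a d\equiv e\pmod{2^n-1}$, or (when $\gcd(d,2^n-1)=1$) $2^a d^{ -1}\equiv e\pmod{2^n-1}$, where $d^{ -1}$ is the inverse of $d$ modulo $2^n-1$. -}

module Defs where

open import Data.Nat using (ℕ; zero; suc; _+_; _*_; _∸_; _^_)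
open import Data.Nat.Coprimality using (Coprime)
open import Data.Integer using (ℤ; +_; _-_)
open import Data.Integer.Divisibility using (_∣_)
open import Data.Product using (Σ; ∃; _×_)
open import Data.Sum using (_⊎_)

e : ℕ → ℕ → ℕ
e zero    K = 0
e (suc l) K = e l K + 2 ^ (l * K)

_≡_[mod_] : ℕ → ℕ → ℕ → Set
x ≡ y [mod N ] = (+ N) ∣ ((+ x) - (+ y))

M : ℕ → ℕ
M n = 2 ^ n ∸ 1

IsInverseMod : ℕ → ℕ → ℕ → Set
IsInverseMod N d d' = (d * d') ≡ 1 [mod N ]

CycEquiv : ℕ → ℕ → ℕ → Set
CycEquiv n d e′ =
  (∃ λ a → (2 ^ a * d) ≡ e′ [mod M n ])
  ⊎ (Coprime d (M n) ×
     ∃ λ d⁻¹ → IsInverseMod (M n) d d⁻¹ × ∃ λ a → (2 ^ a * d⁻¹) ≡ e′ [mod M n ])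

-- Multiplying e(l,K) = Σ_{j<l} 2^{jK} by 2^{(l-1)K′} turns the j-th term into
-- 2^{(l-1-j)K′} · 2^{j(K+K′)}.  When K + K′ = n the second factor is a power of
-- 2^n ≡ 1, so the product is e(l,K′) read backwards.  In both parts of the
-- theorem the two exponents sum to n.
module Submission where

open import Defs
open import Data.Nat using (ℕ; zero; suc; _+_; _*_; _∸_; _^_; _<_; _≤_)
import Data.Nat.Properties as ℕ
open import Data.Integer as ℤ using (ℤ; +_)
import Data.Integer.Properties as ℤ
open import Data.Integer.Divisibility.Signed as Signed using (divides; ∣⇒∣ᵤ)
open import Data.Integer.Tactic.RingSolver using (solve-∀)
open import Data.Product using (_×_; _,_)
open import Data.Sum using (inj₁)
open import Relation.Binary.Bundles using (Setoid)
open import Relation.Binary.PropositionalEquality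
  using (_≡_; sym; trans; cong; cong₂; subst; module ≡-Reasoning)

module Congruence (N : ℕ) where

  -- A record, because the unsigned divisibility in  x ≡ y [mod N ]  does not
  -- let Agda infer x and y.
  record _≈_ (x y : ℕ) : Set where
    constructor mk≈
    field divides-difference : (+ N) Signed.∣ ((+ x) ℤ.- (+ y))

  infix 4 _≈_

  ≈⇒≡[mod] : ∀ {x y} → x ≈ y → x ≡ y [mod N ]
  ≈⇒≡[mod] (mk≈ N∣x-y) = ∣⇒∣ᵤ N∣x-y

  ≈-refl : ∀ {x} → x ≈ x
  ≈-refl {x} = mk≈ (divides ℤ.0ℤ (ℤ.+-inverseʳ (+ x)))

  ≈-sym : ∀ {x y} → x ≈ y → y ≈ x
  ≈-sym {x} {y} (mk≈ N∣x-y) =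
    mk≈ (subst ((+ N) Signed.∣_) (neg-sub (+ x) (+ y)) (Signed.∣m⇒∣-m N∣x-y))
    where
    neg-sub : ∀ a b → ℤ.- (a ℤ.- b) ≡ b ℤ.- a
    neg-sub = solve-∀

  ≈-trans : ∀ {x y z} → x ≈ y → y ≈ z → x ≈ z
  ≈-trans {x} {y} {z} (mk≈ N∣x-y) (mk≈ N∣y-z) =
    mk≈ (subst ((+ N) Signed.∣_) (telescope (+ x) (+ y) (+ z)) (Signed.∣m∣n⇒∣m+n N∣x-y N∣y-z))
    where
    telescope : ∀ a b c → (a ℤ.- b) ℤ.+ (b ℤ.- c) ≡ a ℤ.- c
    telescope = solve-∀

  ≈-setoid : Setoid _ _
  ≈-setoid = record
    { _≈_ = _≈_
    ; isEquivalence = record { refl = ≈-refl ; sym = ≈-sym ; trans = ≈-trans }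
    }

  +-cong : ∀ {a b c d} → a ≈ c → b ≈ d → a + b ≈ c + d
  +-cong {a} {b} {c} {d} (mk≈ N∣a-c) (mk≈ N∣b-d) =
    mk≈ (subst ((+ N) Signed.∣_) difference (Signed.∣m∣n⇒∣m+n N∣a-c N∣b-d))
    where
    regroup : ∀ a b c d → (a ℤ.- c) ℤ.+ (b ℤ.- d) ≡ (a ℤ.+ b) ℤ.- (c ℤ.+ d)
    regroup = solve-∀
    difference : (+ a ℤ.- + c) ℤ.+ (+ b ℤ.- + d) ≡ + (a + b) ℤ.- + (c + d)
    difference = trans (regroup (+ a) (+ b) (+ c) (+ d))
                       (cong₂ ℤ._-_ (sym (ℤ.pos-+ a b)) (sym (ℤ.pos-+ c d)))

  *-congˡ : ∀ c {a b} → a ≈ b → c * a ≈ c * b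
  *-congˡ c {a} {b} (mk≈ N∣a-b) =
    mk≈ (subst ((+ N) Signed.∣_) difference (Signed.∣n⇒∣m*n (+ c) N∣a-b))
    where
    distrib : ∀ c a b → c ℤ.* (a ℤ.- b) ≡ c ℤ.* a ℤ.- c ℤ.* b
    distrib = solve-∀
    difference : + c ℤ.* (+ a ℤ.- + b) ≡ + (c * a) ℤ.- + (c * b)
    difference = trans (distrib (+ c) (+ a) (+ b))
                       (cong₂ ℤ._-_ (sym (ℤ.pos-* c a)) (sym (ℤ.pos-* c b)))

open Congruence using (mk≈; ≈⇒≡[mod]; ≈-refl; ≈-setoid; +-cong; *-congˡ)

2^n≈1 : ∀ n → Congruence._≈_ (M n) (2 ^ n) 1
2^n≈1 n = mk≈ (divides (+ 1) (trans M≡2^n-1 (sym (ℤ.*-identityˡ (+ M n)))))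
  where
  M≡2^n-1 : + (2 ^ n) ℤ.- + 1 ≡ + M n
  M≡2^n-1 = trans (ℤ.m-n≡m⊖n (2 ^ n) 1) (ℤ.⊖-≥ (ℕ.m^n>0 2 n))

2^[j*n]≈1 : ∀ n j → Congruence._≈_ (M n) (2 ^ (j * n)) 1
2^[j*n]≈1 n zero = ≈-refl (M n)
2^[j*n]≈1 n (suc j) = begin
  2 ^ (n + j * n)    ≡⟨ ℕ.^-distribˡ-+-* 2 n (j * n) ⟩
  2 ^ n * 2 ^ (j * n) ≈⟨ *-congˡ (M n) (2 ^ n) (2^[j*n]≈1 n j) ⟩
  2 ^ n * 1          ≡⟨ ℕ.*-identityʳ (2 ^ n) ⟩
  2 ^ n              ≈⟨ 2^n≈1 n ⟩
  1                  ∎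
  where open import Relation.Binary.Reasoning.Setoid (≈-setoid (M n))

e-suc-horner : ∀ l K → e (suc l) K ≡ 1 + 2 ^ K * e l K
e-suc-horner zero K = cong suc (sym (ℕ.*-zeroʳ (2 ^ K)))
e-suc-horner (suc l) K = begin
  e (suc l) K + 2 ^ (K + l * K)
    ≡⟨ cong₂ _+_ (e-suc-horner l K) (ℕ.^-distribˡ-+-* 2 K (l * K)) ⟩
  1 + 2 ^ K * e l K + 2 ^ K * 2 ^ (l * K)
    ≡⟨ ℕ.+-assoc 1 (2 ^ K * e l K) (2 ^ K * 2 ^ (l * K)) ⟩
  1 + (2 ^ K * e l K + 2 ^ K * 2 ^ (l * K))
    ≡⟨ cong suc (sym (ℕ.*-distribˡ-+ (2 ^ K) (e l K) (2 ^ (l * K)))) ⟩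
  1 + 2 ^ K * e (suc l) K ∎
  where open ≡-Reasoning

-- The new last term of e(l+2,K) absorbs the whole multiplier 2^{(l+1)K′},
-- producing the power 2^{(l+1)n} ≡ 1 that becomes the new first term of e(l+2,K′).
2^[l*K′]*e[1+l,K]≈e[1+l,K′] : ∀ {K K′ n} → K + K′ ≡ n → ∀ l →
  Congruence._≈_ (M n) (2 ^ (l * K′) * e (suc l) K) (e (suc l) K′)
2^[l*K′]*e[1+l,K]≈e[1+l,K′] {n = n} K+K′≡n zero = ≈-refl (M n)
2^[l*K′]*e[1+l,K]≈e[1+l,K′] {K} {K′} {n} K+K′≡n (suc l) = begin
  2 ^ (suc l * K′) * (E + 2 ^ (suc l * K))
    ≡⟨ ℕ.*-distribˡ-+ (2 ^ (suc l * K′)) E _ ⟩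
  2 ^ (suc l * K′) * E + 2 ^ (suc l * K′) * 2 ^ (suc l * K)
    ≡⟨ cong₂ _+_ (trans (cong (_* E) (ℕ.^-distribˡ-+-* 2 K′ (l * K′)))
                        (ℕ.*-assoc (2 ^ K′) (2 ^ (l * K′)) E))
                 (sym (ℕ.^-distribˡ-+-* 2 (suc l * K′) (suc l * K))) ⟩
  2 ^ K′ * (2 ^ (l * K′) * E) + 2 ^ (suc l * K′ + suc l * K)
    ≡⟨ cong (λ t → 2 ^ K′ * (2 ^ (l * K′) * E) + 2 ^ t)
            (trans (sym (ℕ.*-distribˡ-+ (suc l) K′ K))
                   (cong (suc l *_) (trans (ℕ.+-comm K′ K) K+K′≡n))) ⟩
  2 ^ K′ * (2 ^ (l * K′) * E) + 2 ^ (suc l * n)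
    ≈⟨ +-cong (M n) (*-congˡ (M n) (2 ^ K′) (2^[l*K′]*e[1+l,K]≈e[1+l,K′] K+K′≡n l))
                    (2^[j*n]≈1 n (suc l)) ⟩
  2 ^ K′ * e (suc l) K′ + 1
    ≡⟨ trans (ℕ.+-comm _ 1) (sym (e-suc-horner (suc l) K′)) ⟩
  e (suc (suc l)) K′ ∎
  where
  open import Relation.Binary.Reasoning.Setoid (≈-setoid (M n))
  E : ℕ
  E = e (suc l) K

e-cycEquiv : ∀ {K K′ n} → K + K′ ≡ n → ∀ l → CycEquiv n (e l K) (e l K′)
e-cycEquiv {n = n} K+K′≡n zero = inj₁ (0 , ≈⇒≡[mod] (M n) (≈-refl (M n) {0}))
e-cycEquiv {K′ = K′} {n} K+K′≡n (suc l) =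
  inj₁ (l * K′ , ≈⇒≡[mod] (M n) (2^[l*K′]*e[1+l,K]≈e[1+l,K′] K+K′≡n l))

m∸k+[m+k]≡2*m : ∀ {k m} → k ≤ m → m ∸ k + (m + k) ≡ 2 * m
m∸k+[m+k]≡2*m {k} {m} k≤m = begin
  m ∸ k + (m + k) ≡⟨ cong (λ t → m ∸ k + t) (ℕ.+-comm m k) ⟩
  m ∸ k + (k + m) ≡⟨ sym (ℕ.+-assoc (m ∸ k) k m) ⟩
  m ∸ k + k + m   ≡⟨ cong (_+ m) (ℕ.m∸n+n≡m k≤m) ⟩
  m + m           ≡⟨ cong (λ t → m + t) (sym (ℕ.+-identityʳ m)) ⟩
  2 * m           ∎
  where open ≡-Reasoning

m∸k+1+[m+k]≡2*m+1 : ∀ {k m} → k ≤ m → m ∸ k + 1 + (m + k) ≡ 2 * m + 1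
m∸k+1+[m+k]≡2*m+1 {k} {m} k≤m = begin
  m ∸ k + 1 + (m + k)   ≡⟨ cong (_+ (m + k)) (ℕ.+-comm (m ∸ k) 1) ⟩
  suc (m ∸ k + (m + k)) ≡⟨ cong suc (m∸k+[m+k]≡2*m k≤m) ⟩
  suc (2 * m)           ≡⟨ ℕ.+-comm 1 (2 * m) ⟩
  2 * m + 1             ∎
  where open ≡-Reasoning

lemma2 :
    (∀ (l k m n : ℕ) → n ≡ 2 * m → k < m → CycEquiv n (e l (m ∸ k)) (e l (m + k)))
    × (∀ (l k m n : ℕ) → n ≡ 2 * m + 1 → k ≤ m → CycEquiv n (e l (m ∸ k + 1)) (e l (m + k)))
lemma2 =
    (λ l k m n n≡2m k<m →
       e-cycEquiv (trans (m∸k+[m+k]≡2*m (ℕ.<⇒≤ k<m)) (sym n≡2m)) l)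
  , (λ l k m n n≡2m+1 k≤m →
       e-cycEquiv (trans (m∸k+1+[m+k]≡2*m+1 k≤m) (sym n≡2m+1)) l)
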